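{- Let $W=(N,w,\tau)$ be a TPWN, let $\sigma$ be an occurrence sequence of $W$ with $\mathbf{i}\xrightarrow{\sigma}M$, and let $C\in\mathcal{C}(M)$ be a conflict set enabled at $M$. Then for every transition $t\in C$ we have $\mathit{start}(\sigma t)=\max_{q\in{}^\bullet C}\mu(\sigma)_q$. In particular, all transitions of $C$ have the same earliest starting time after $\sigma$.
   Context: A workflow net is $N=(P,T,F,i,o)$: $P,T$ disjoint finite sets, $F\subseteq(P\times T)\cup(T\times P)$, $i$ without incoming and $o$ without outgoing arcs, $(P\cup T,F\cup\{(o,i)\})$ strongly connected. ${}^\bullet x=\{y:(y,x)\in F\}$, $x^\bullet=\{y:(x,y)\in F\}$, extended to sets by union. Markings, firing $M\xrightarrow{t}M'$ (remove one token from each place of ${}^\bullet t$, add one to each place of $t^\bullet$) and occurrence (firing) sequences as usual; $\mathbf{i}$ has one token in $i$ and none elsewhere. 1-safe: every reachable marking has at most one token per place (identified with a set of places). Transitions are independent if their presets are disjoint, dependent otherwise; at a 1-safe marking $M$ two enabled transitions are concurrent if independent and in conflict if dependent; $C(t,M)$ is the set of transitions in conflict with $t$ at $M$ (contains $t$), and $\mathcal{C}(M)=\{C(t,M):t\text{ enabled at }M\}$. Confusion-free: for every reachable $M$, enabled $t$, and $u$ concurrent with $t$ at $M$: $C(u,M)=C(u,M\setminus{}^\bullet t)=C(u,(M\setminus{}^\bullet t)\cup t^\bullet)$. A TPWN is $W=(N,w,\tau)$ with $N$ 1-safe confusion-free, $w:T\to\mathbb{Q}_{>0}$, $\tau:T\to\mathbb{N}$.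 Timing: $\mathbb{N}_\bot=\{\bot\}\cup\mathbb{N}$, $\bot\le x$, $\bot+x=\bot$; $upd(\vec x,t)_p=\max_{q\in{}^\bullet t}\vec x_q+\tau(t)$ if $p\in t^\bullet$, $\bot$ if $p\in{}^\bullet t\setminus t^\bullet$, $\vec x_p$ otherwise; $\mu(\epsilon)_i=0$, $\mu(\epsilon)_p=\bot$ ($p\ne i$), $\mu(\sigma t)=upd(\mu(\sigma),t)$. The earliest starting time of the last transition of a sequence is $\mathit{start}(\epsilon)=0$ and $\mathit{start}(\sigma t)=\max_{q\in{}^\bullet t}\mu(\sigma)_q$. -}

module Defs where

open import Data.Nat using (ℕ; zero; suc; _+_; _∸_; _≤_; _⊔_; _≤?_)
open import Data.Bool using (Bool; true; false; if_then_else_)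
open import Data.Fin using (Fin; _≟_)
open import Data.Fin.Properties using (any?; all?)
open import Data.List using (List; []; _∷_; foldl; foldr; allFin; unsnoc)
open import Data.Maybe using (Maybe; just; nothing)
import Data.Maybe as Maybe
open import Data.Product using (Σ; ∃; _×_; _,_)
open import Data.Sum using (_⊎_)
open import Data.Rational using (ℚ; 0ℚ; _<_)
open import Relation.Nullary using (Dec; does; yes; no; ¬_)
open import Relation.Nullary.Decidable using (_×-dec_; _→-dec_)
open import Relation.Unary using (Decidable)
open import Relation.Binary.PropositionalEquality using (_≡_)
open import Relation.Binary.Construct.Closure.ReflexiveTransitive using (Star)
open import Data.Bool.Properties using () renaming (_≟_ to _≟ᵇ_)
open import Function.Bundles using (_⇔_)

-- The flow relation F ⊆ (P×T) ∪ (T×P) is given by two Boolean relations: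
--   pre  t p ≡ true  iff (p , t) ∈ F   (p ∈ •t)
--   post t p ≡ true  iff (t , p) ∈ F   (p ∈ t•)

data Node (nP nT : ℕ) : Set where
  place : Fin nP → Node nP nT
  trans : Fin nT → Node nP nT

data Edge {nP nT : ℕ} (pre post : Fin nT → Fin nP → Bool) (i o : Fin nP)
     : Node nP nT → Node nP nT → Set where
  p→t : ∀ {p t} → pre t p ≡ true → Edge pre post i o (place p) (trans t)
  t→p : ∀ {t p} → post t p ≡ true → Edge pre post i o (trans t) (place p)
  o→i : Edge pre post i o (place o) (place i)

record WorkflowNet : Set where
  field
    nP nT : ℕ
    pre   : Fin nT → Fin nP → Bool
    post  : Fin nT → Fin nP → Bool
    i o   : Fin nP
    i-no-incoming : ∀ t → post t i ≡ false
    o-no-outgoing : ∀ t → pre t o ≡ false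
    strongly-connected : ∀ x y → Star (Edge pre post i o) x y

module _ (N : WorkflowNet) where
  open WorkflowNet N

  Place = Fin nP
  Transition = Fin nT

  Marking : Set
  Marking = Place → ℕ

  initial : Marking
  initial p = if does (p ≟ i) then 1 else 0

  Enabled : Marking → Transition → Set
  Enabled M t = ∀ p → pre t p ≡ true → 1 ≤ M p

  enabled? : (M : Marking) → Decidable (Enabled M)
  enabled? M t = all? (λ p → (pre t p ≟ᵇ true) →-dec (1 ≤? M p))

  fire : Marking → Transition → Marking
  fire M t p = (M p ∸ (if pre t p then 1 else 0)) + (if post t p then 1 else 0)

  data Run : Marking → List Transition → Marking → Set where
    done : ∀ {M} → Run M [] M
    step : ∀ {M t σ M'} → Enabled M t → Run (fire M t) σ M' → Run M (t ∷ σ) M'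

  Reachable : Marking → Set
  Reachable M = ∃ λ σ → Run initial σ M

  OneSafe : Set
  OneSafe = ∀ M → Reachable M → ∀ p → M p ≤ 1

  -- (for 1-safe markings, viewed as sets of places)
  -- M ∖ •t
  removePre : Marking → Transition → Marking
  removePre M t p = if pre t p then 0 else M p

  addPost : Marking → Transition → Marking
  addPost M t p = if post t p then 1 else M p

  Independent : Transition → Transition → Set
  Independent t u = ∀ p → pre t p ≡ true → pre u p ≡ false

  Dependent : Transition → Transition → Set
  Dependent t u = ∃ λ p → pre t p ≡ true × pre u p ≡ true

  dependent? : (t : Transition) → Decidable (Dependent t)
  dependent? t u = any? (λ p → (pre t p ≟ᵇ true) ×-dec (pre u p ≟ᵇ true))

  Concurrent : Marking → Transition → Transition → Set
  Concurrent M t u = Enabled M t × Enabled M u × Independent t u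

  ConflictSet : Transition → Marking → Transition → Set
  ConflictSet t M u = Enabled M u × Dependent t u

  conflictSet? : (t : Transition) (M : Marking) → Decidable (ConflictSet t M)
  conflictSet? t M u = enabled? M u ×-dec dependent? t u

  SameConflictSet : Transition → Marking → Marking → Set
  SameConflictSet u M M' = ∀ v → ConflictSet u M v ⇔ ConflictSet u M' v

  ConfusionFree : Set
  ConfusionFree = ∀ M → Reachable M → ∀ t u → Enabled M t → Concurrent M t u →
      SameConflictSet u M (removePre M t)
    × SameConflictSet u M (addPost (removePre M t) t)

  PresetOf : (Transition → Set) → Place → Set
  PresetOf C q = ∃ λ v → C v × pre v q ≡ true

  presetOf? : {C : Transition → Set} → Decidable C → Decidable (PresetOf C)
  presetOf? C? q = any? (λ v → C? v ×-dec (pre v q ≟ᵇ true))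

record TPWN : Set where
  field
    net  : WorkflowNet
  open WorkflowNet net public
  field
    one-safe       : OneSafe net
    confusion-free : ConfusionFree net
    w              : Fin nT → ℚ
    w-positive     : ∀ t → 0ℚ < w t
    τ              : Fin nT → ℕ

ℕ⊥ : Set
ℕ⊥ = Maybe ℕ

⊥ : ℕ⊥
⊥ = nothing

max⊥ : ℕ⊥ → ℕ⊥ → ℕ⊥
max⊥ nothing  y        = y
max⊥ (just x) nothing  = just x
max⊥ (just x) (just y) = just (x ⊔ y)

_+⊥_ : ℕ⊥ → ℕ → ℕ⊥
x +⊥ k = Maybe.map (_+ k) x

maxOver : ∀ {n} {S : Fin n → Set} → Decidable S → (Fin n → ℕ⊥) → ℕ⊥
maxOver {n} S? f = foldr (λ p acc → if does (S? p) then max⊥ (f p) acc else acc) ⊥ (allFin n)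

module _ (W : TPWN) where
  open TPWN W

  maxPre : Fin nT → (Fin nP → ℕ⊥) → ℕ⊥
  maxPre t x = maxOver (λ q → pre t q ≟ᵇ true) x

  upd : (Fin nP → ℕ⊥) → Fin nT → (Fin nP → ℕ⊥)
  upd x t p = if post t p then maxPre t x +⊥ τ t
              else if pre t p then ⊥ else x p

  μ₀ : Fin nP → ℕ⊥
  μ₀ p = if does (p ≟ i) then just 0 else ⊥

  μ : List (Fin nT) → Fin nP → ℕ⊥
  μ σ = foldl upd μ₀ σ

  start : List (Fin nT) → ℕ⊥
  start σ with unsnoc σ
  ... | nothing      = just 0
  ... | just (ρ , t) = maxPre t (μ ρ)

-- The inequality start(σ t) ≤ max over •C is immediate since •t ⊆ •C. Conversely, every
-- v ∈ C is in conflict with t (otherwise firing t would disable t₀, against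
-- confusion-freeness), so it suffices to bound μ(σ)_q for q ∈ •v by the times on •t.
-- Let y be the last transition of σ that produced the token on q, at time T (if there
-- is none, q is the initial place and μ(σ)_q = 0, below any defined time). A later
-- transition either consumes a place already marked downstream of y, and then produces
-- at time ≥ T, or it is disjoint from everything downstream of y and can be moved
-- before y without changing the markings or the times. At the end either •t contains a
-- place downstream of y, which gives the bound, or •t is untouched since before y; then
-- confusion-freeness carries the conflict between t and v back to the marking before y,
-- where q would already be marked and y would put a second token on it.
module Submission where

open import Defs
open import Data.Bool using (true; false; if_then_else_)
open import Data.Bool.Properties using (¬-not; not-¬) renaming (_≟_ to _≟ᵇ_)
open import Data.Empty using (⊥-elim)
open import Data.Fin using (Fin; _≟_)
open import Data.Fin.Properties using (any?)
open import Data.List using (List; []; _∷_; _++_; _∷ʳ_; foldl; foldr; allFin; initLast; _∷ʳ′_)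
open import Data.List.Properties using (foldl-++; foldl-∷ʳ)
open import Data.List.Membership.Propositional using (_∈_)
open import Data.List.Membership.Propositional.Properties using (∈-allFin)
open import Data.List.Relation.Unary.Any as Any using (Any; here; there)
open import Data.List.Relation.Unary.Any.Properties using (++⁻)
open import Data.Maybe using (just; nothing)
open import Data.Nat using (_+_; _∸_; _≤_; z≤n; s≤s)
open import Data.Nat.Properties
  using ( ≤-refl; ≤-reflexive; ≤-trans; ≤-antisym; m≤m⊔n; m≤n⊔m; ⊔-lub; m≤m+n; m≤n+m
        ; +-identityʳ; +-monoˡ-≤; m≤n⇒m∸n≡0)
open import Data.Product using (∃; _×_; _,_; proj₁; proj₂)
open import Data.Sum using (_⊎_; inj₁; inj₂)
open import Function using (_∘_)
open import Function.Bundles using (Equivalence)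
open import Relation.Binary.Construct.Closure.ReflexiveTransitive using (Star; _◅_)
open import Level using (0ℓ)
open import Relation.Binary.Bundles using (Preorder)
open import Relation.Binary.Structures using (IsPreorder)
import Relation.Binary.Reasoning.Preorder
open import Relation.Binary.PropositionalEquality
  using (_≡_; _≗_; refl; sym; cong; cong-app; subst; isEquivalence) renaming (trans to ≡-trans)
open import Relation.Nullary using (¬_; yes; no; does; contradiction)
open import Relation.Nullary.Decidable using (_×-dec_; _⊎-dec_)
open import Relation.Unary using (Decidable)

infix 4 _≤⊥_

data _≤⊥_ : ℕ⊥ → ℕ⊥ → Set where
  ⊥≤ : ∀ {x} → ⊥ ≤⊥ x
  just≤just : ∀ {m n} → m ≤ n → just m ≤⊥ just n

≤⊥-refl : ∀ {x} → x ≤⊥ x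
≤⊥-refl {nothing} = ⊥≤
≤⊥-refl {just x} = just≤just ≤-refl

≤⊥-reflexive : ∀ {x y} → x ≡ y → x ≤⊥ y
≤⊥-reflexive refl = ≤⊥-refl

≤⊥-trans : ∀ {x y z} → x ≤⊥ y → y ≤⊥ z → x ≤⊥ z
≤⊥-trans ⊥≤ _ = ⊥≤
≤⊥-trans (just≤just p) (just≤just q) = just≤just (≤-trans p q)

≤⊥-antisym : ∀ {x y} → x ≤⊥ y → y ≤⊥ x → x ≡ y
≤⊥-antisym ⊥≤ ⊥≤ = refl
≤⊥-antisym (just≤just p) (just≤just q) = cong just (≤-antisym p q)

≤⊥-isPreorder : IsPreorder _≡_ _≤⊥_
≤⊥-isPreorder = record
  { isEquivalence = isEquivalence ; reflexive = ≤⊥-reflexive ; trans = ≤⊥-trans }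

≤⊥-preorder : Preorder 0ℓ 0ℓ 0ℓ
≤⊥-preorder = record { isPreorder = ≤⊥-isPreorder }

module ≤⊥-Reasoning = Relation.Binary.Reasoning.Preorder ≤⊥-preorder

just≤⊥⇒just : ∀ {n y} → just n ≤⊥ y → ∃ λ m → y ≡ just m
just≤⊥⇒just (just≤just {n = m} _) = m , refl

max⊥-upperˡ : ∀ x y → x ≤⊥ max⊥ x y
max⊥-upperˡ nothing y = ⊥≤
max⊥-upperˡ (just x) nothing = ≤⊥-refl
max⊥-upperˡ (just x) (just y) = just≤just (m≤m⊔n x y)

max⊥-upperʳ : ∀ x y → y ≤⊥ max⊥ x y
max⊥-upperʳ nothing y = ≤⊥-refl
max⊥-upperʳ (just x) nothing = ⊥≤
max⊥-upperʳ (just x) (just y) = just≤just (m≤n⊔m x y)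

max⊥-lub : ∀ {x y b} → x ≤⊥ b → y ≤⊥ b → max⊥ x y ≤⊥ b
max⊥-lub {nothing} _ q = q
max⊥-lub {just x} {nothing} p _ = p
max⊥-lub {just x} {just y} (just≤just p) (just≤just q) = just≤just (⊔-lub p q)

+⊥-inflationary : ∀ x k → x ≤⊥ x +⊥ k
+⊥-inflationary nothing k = ⊥≤
+⊥-inflationary (just x) k = just≤just (m≤m+n x k)

module _ {n} {S : Fin n → Set} (S? : Decidable S) (f : Fin n → ℕ⊥) where

  private
    maxOverList : List (Fin n) → ℕ⊥
    maxOverList = foldr (λ p acc → if does (S? p) then max⊥ (f p) acc else acc) ⊥

    maxOverList-upper : ∀ {q} xs → q ∈ xs → S q → f q ≤⊥ maxOverList xs
    maxOverList-upper (p ∷ xs) q∈ s with S? p | q∈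
    ... | yes _ | here refl = max⊥-upperˡ _ _
    ... | yes _ | there q∈xs = ≤⊥-trans (maxOverList-upper xs q∈xs s) (max⊥-upperʳ _ _)
    ... | no ¬s | here refl = contradiction s ¬s
    ... | no _ | there q∈xs = maxOverList-upper xs q∈xs s

    maxOverList-lub : ∀ {b} xs → (∀ q → S q → f q ≤⊥ b) → maxOverList xs ≤⊥ b
    maxOverList-lub [] _ = ⊥≤
    maxOverList-lub (p ∷ xs) h with S? p
    ... | yes s = max⊥-lub (h p s) (maxOverList-lub xs h)
    ... | no _ = maxOverList-lub xs h

  maxOver-upper : ∀ q → S q → f q ≤⊥ maxOver S? f
  maxOver-upper q = maxOverList-upper (allFin n) (∈-allFin q)

  maxOver-lub : ∀ {b} → (∀ q → S q → f q ≤⊥ b) → maxOver S? f ≤⊥ b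
  maxOver-lub = maxOverList-lub (allFin n)

maxOver-cong : ∀ {n} {S : Fin n → Set} (S? : Decidable S) {f g : Fin n → ℕ⊥} →
  (∀ q → S q → f q ≡ g q) → maxOver S? f ≡ maxOver S? g
maxOver-cong S? {f} {g} f≡g = ≤⊥-antisym
  (maxOver-lub S? f (λ q s → ≤⊥-trans (≤⊥-reflexive (f≡g q s)) (maxOver-upper S? g q s)))
  (maxOver-lub S? g (λ q s → ≤⊥-trans (≤⊥-reflexive (sym (f≡g q s))) (maxOver-upper S? f q s)))

initLast-∷ʳ : ∀ {A : Set} (xs : List A) x → initLast (xs ∷ʳ x) ≡ (xs ∷ʳ′ x)
initLast-∷ʳ [] x = refl
initLast-∷ʳ (y ∷ xs) x rewrite initLast-∷ʳ xs x = refl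

start-∷ʳ : ∀ W σ t → start W (σ ∷ʳ t) ≡ maxPre W t (μ W σ)
start-∷ʳ W σ t rewrite initLast-∷ʳ σ t = refl

data LastOccurrence {A : Set} (P : A → Set) : List A → Set where
  none : ∀ {xs} → ¬ Any P xs → LastOccurrence P xs
  at   : ∀ xs₁ {x} xs₂ → P x → ¬ Any P xs₂ → LastOccurrence P (xs₁ ++ x ∷ xs₂)

lastOccurrence : ∀ {A : Set} {P : A → Set} → Decidable P → ∀ xs → LastOccurrence P xs
lastOccurrence P? [] = none λ ()
lastOccurrence P? (x ∷ xs) with lastOccurrence P? xs
... | at xs₁ xs₂ px later = at (x ∷ xs₁) xs₂ px later
... | none absent with P? x
...   | yes px = at [] xs px absent
...   | no ¬px = none λ { (here px) → ¬px px ; (there any) → absent any }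

module _ (W : TPWN) where
  open TPWN W

  Touches : Fin nT → Fin nP → Set
  Touches w p = pre w p ≡ true ⊎ post w p ≡ true

  touches? : ∀ w → Decidable (Touches w)
  touches? w p = (pre w p ≟ᵇ true) ⊎-dec (post w p ≟ᵇ true)

  TouchesAny : List (Fin nT) → Fin nP → Set
  TouchesAny Y p = Any (λ w → Touches w p) Y

  touchesAny? : ∀ Y → Decidable (TouchesAny Y)
  touchesAny? Y p = Any.any? (λ w → touches? w p) Y

  untouched-pre : ∀ {w p} → ¬ Touches w p → pre w p ≡ false
  untouched-pre h = ¬-not (h ∘ inj₁)

  untouched-post : ∀ {w p} → ¬ Touches w p → post w p ≡ false
  untouched-post h = ¬-not (h ∘ inj₂)

  fire-untouched : ∀ M {w p} → ¬ Touches w p → fire net M w p ≡ M p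
  fire-untouched M {p = p} h rewrite untouched-pre h | untouched-post h = +-identityʳ (M p)

  fire-output : ∀ M {w p} → post w p ≡ true → 1 ≤ fire net M w p
  fire-output M e rewrite e = m≤n+m 1 _

  fire-unconsumed : ∀ M {w p} → pre w p ≡ false → M p ≤ fire net M w p
  fire-unconsumed M {p = p} e rewrite e = m≤m+n (M p) _

  fire-pointwise : ∀ M M' w {p} → M p ≡ M' p → fire net M w p ≡ fire net M' w p
  fire-pointwise _ _ w {p} =
    cong (λ m → (m ∸ (if pre w p then 1 else 0)) + (if post w p then 1 else 0))

  fire-comm : ∀ M z w → (∀ p → Touches z p → ¬ Touches w p) →
    fire net (fire net M w) z ≗ fire net (fire net M z) w
  fire-comm M z w disjoint p with touches? z p
  ... | yes tz = ≡-trans (fire-pointwise (fire net M w) M z (fire-untouched M (disjoint p tz)))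
                       (sym (fire-untouched (fire net M z) (disjoint p tz)))
  ... | no ¬tz = ≡-trans (fire-untouched (fire net M w) ¬tz)
                       (fire-pointwise M (fire net M z) w (sym (fire-untouched M ¬tz)))

  enabled-cong : ∀ {M M' w} → M ≗ M' → Enabled net M w → Enabled net M' w
  enabled-cong M≗M' e p wp = subst (1 ≤_) (M≗M' p) (e p wp)

  run-cong : ∀ {M M' M''} Y → Run net M Y M'' → M ≗ M' → ∃ λ M''' → Run net M' Y M''' × M'' ≗ M'''
  run-cong [] done M≗M' = _ , done , M≗M'
  run-cong {M} {M'} (w ∷ Y) (step e r) M≗M' with run-cong Y r (λ p → fire-pointwise M M' w (M≗M' p))
  ... | M''' , r' , M''≗M''' = M''' , step (enabled-cong M≗M' e) r' , M''≗M'''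

  run-++ : ∀ {M M' M''} Y {Z} → Run net M Y M' → Run net M' Z M'' → Run net M (Y ++ Z) M''
  run-++ [] done r = r
  run-++ (w ∷ Y) (step e r) r' = step e (run-++ Y r r')

  run-++⁻ : ∀ {M M''} Y {Z} → Run net M (Y ++ Z) M'' → ∃ λ M' → Run net M Y M' × Run net M' Z M''
  run-++⁻ [] r = _ , done , r
  run-++⁻ (w ∷ Y) (step e r) with run-++⁻ Y r
  ... | M' , r₁ , r₂ = M' , step e r₁ , r₂

  run-untouched : ∀ {M M'} Y {p} → Run net M Y M' → ¬ TouchesAny Y p → M' p ≡ M p
  run-untouched [] done _ = refl
  run-untouched {M} (w ∷ Y) (step _ r) h =
    ≡-trans (run-untouched Y r (h ∘ there)) (fire-untouched M (h ∘ here))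

  untouched-enabled : ∀ {M M' t} Y → Run net M Y M' → Enabled net M' t →
    (∀ p → pre t p ≡ true → ¬ TouchesAny Y p) → Enabled net M t
  untouched-enabled Y r e h p tp = subst (1 ≤_) (run-untouched Y r (h p tp)) (e p tp)

  untouched⇒independent : ∀ {w t Y} → (∀ p → pre t p ≡ true → ¬ TouchesAny (w ∷ Y) p) →
    Independent net w t
  untouched⇒independent h p wp = ¬-not (λ tp → h p tp (here (inj₁ wp)))

  reachable-run : ∀ {M M'} Y → Reachable net M → Run net M Y M' → Reachable net M'
  reachable-run Y (σ , r) r' = σ ++ Y , run-++ σ r r'

  reachable-fire : ∀ {M w} → Reachable net M → Enabled net M w → Reachable net (fire net M w)
  reachable-fire R e = reachable-run (_ ∷ []) R (step e done)

  marked-output⇒consumed : ∀ {M w p} → Reachable net M → Enabled net M w →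
    post w p ≡ true → 1 ≤ M p → pre w p ≡ true
  marked-output⇒consumed {M} {w} {p} R e w·p marked with pre w p in wp
  ... | true = refl
  ... | false =
    contradiction (≤-trans two-tokens (one-safe _ (reachable-fire R e) p)) λ { (s≤s ()) }
    where
    two-tokens : 2 ≤ fire net M w p
    two-tokens rewrite wp | w·p = +-monoˡ-≤ 1 marked

  marked-after-fire : ∀ {M w p} → Reachable net M → 1 ≤ fire net M w p →
    post w p ≡ true ⊎ (¬ Touches w p × 1 ≤ M p)
  marked-after-fire {M} {w} {p} R marked with post w p in w·p | pre w p in wp
  ... | true | _ = inj₁ refl
  ... | false | true
    with () ← ≤-trans marked (≤-reflexive (≡-trans (+-identityʳ _) (m≤n⇒m∸n≡0 (one-safe M R p))))
  ... | false | false = inj₂ ((λ { (inj₁ ()) ; (inj₂ ()) }) , subst (1 ≤_) (+-identityʳ _) marked)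

  touched-marked⇒output : ∀ {M w p} → Reachable net M → Touches w p → 1 ≤ fire net M w p →
    post w p ≡ true
  touched-marked⇒output R wp marked with marked-after-fire R marked
  ... | inj₁ w·p = w·p
  ... | inj₂ (¬wp , _) = contradiction wp ¬wp

  -- A transition with empty preset could fire twice in a row, and by strong
  -- connectivity it has an output place, which would then carry two tokens.
  preset-nonempty : ∀ w → ∃ λ p → pre w p ≡ true
  preset-nonempty w with any? (λ p → pre w p ≟ᵇ true)
  ... | yes found = found
  ... | no empty = ⊥-elim (has-no-output (strongly-connected (trans w) (place i)))
    where
    always-enabled : ∀ M → Enabled net M w
    always-enabled M p wp = contradiction (p , wp) empty

    has-no-output : ¬ Star (Edge pre post i o) (trans w) (place i)
    has-no-output (t→p {p = p} w·p ◅ _) = empty (p ,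
      marked-output⇒consumed (reachable-fire ([] , done) (always-enabled _)) (always-enabled _)
        w·p (fire-output (initial net) w·p))

  removePre-marked : ∀ M {w p} → 1 ≤ removePre net M w p → pre w p ≡ false × 1 ≤ M p
  removePre-marked M {w} {p} marked with pre w p
  ... | false = refl , marked

  fire-marked⇒addPost-marked : ∀ {M w p} → Reachable net M → 1 ≤ fire net M w p →
    1 ≤ addPost net (removePre net M w) w p
  fire-marked⇒addPost-marked {w = w} {p} R marked with marked-after-fire R marked
  ... | inj₁ w·p rewrite w·p = s≤s z≤n
  ... | inj₂ (¬wp , marked₀) rewrite untouched-post ¬wp | untouched-pre ¬wp = marked₀

  dependent-sym : ∀ {t u} → Dependent net t u → Dependent net u t
  dependent-sym (p , tp , up) = p , up , tp

  conflict-backward : ∀ {A B t v} Y → Reachable net A → Run net A Y B → Enabled net B t →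
    (∀ p → pre t p ≡ true → ¬ TouchesAny Y p) → ConflictSet net t B v → ConflictSet net t A v
  conflict-backward [] _ done _ _ c = c
  conflict-backward {A} {t = t} {v} (w ∷ Y) R r@(step ew r') et free c
    with conflict-backward Y (reachable-fire R ew) r' et (λ p tp → free p tp ∘ there) c
  ... | ev , dep =
    Equivalence.from (proj₂ cf v) ((λ p vp → fire-marked⇒addPost-marked R (ev p vp)) , dep)
    where
    cf = confusion-free A R w t ew
      (ew , untouched-enabled (w ∷ Y) r et free , untouched⇒independent free)

  conflictSet-dependent : ∀ {M t₀ t v} → Reachable net M → Enabled net M t₀ →
    ConflictSet net t₀ M t → ConflictSet net t₀ M v → Dependent net t v
  conflictSet-dependent {M} {t₀} {t} {v} R et₀ (et , p , t₀p , tp) (ev , dep₀v)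
    with dependent? net t v
  ... | yes dep = dep
  ... | no indep = contradiction tp (not-¬ t-kept)
    where
    cf = confusion-free M R t v et (et , ev , λ q tq → ¬-not (λ vq → indep (q , tq , vq)))
    t₀-enabled : Enabled net (removePre net M t) t₀
    t₀-enabled = proj₁ (Equivalence.to (proj₁ cf t₀) (et₀ , dependent-sym dep₀v))
    t-kept : pre t p ≡ false
    t-kept = proj₁ (removePre-marked M (t₀-enabled p t₀p))

  maxPre-upper : ∀ w x {p} → pre w p ≡ true → x p ≤⊥ maxPre W w x
  maxPre-upper w x {p} = maxOver-upper (λ q → pre w q ≟ᵇ true) x p

  maxPre-cong : ∀ w {x y} → (∀ q → pre w q ≡ true → x q ≡ y q) → maxPre W w x ≡ maxPre W w y
  maxPre-cong w = maxOver-cong (λ q → pre w q ≟ᵇ true)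

  upd-output : ∀ x {w p} → post w p ≡ true → upd W x w p ≡ maxPre W w x +⊥ τ w
  upd-output x w·p rewrite w·p = refl

  upd-untouched : ∀ x {w p} → ¬ Touches w p → upd W x w p ≡ x p
  upd-untouched x h rewrite untouched-post h | untouched-pre h = refl

  upd-local : ∀ w {x y} p → (∀ q → pre w q ≡ true → x q ≡ y q) → x p ≡ y p →
    upd W x w p ≡ upd W y w p
  upd-local w p on-pre at-p with post w p | pre w p
  ... | true | _ = cong (_+⊥ τ w) (maxPre-cong w on-pre)
  ... | false | true = refl
  ... | false | false = at-p

  upds-cong : ∀ Y {x y} → x ≗ y → foldl (upd W) x Y ≗ foldl (upd W) y Y
  upds-cong [] x≗y = x≗y
  upds-cong (w ∷ Y) x≗y = upds-cong Y (λ p → upd-local w p (λ q _ → x≗y q) (x≗y p))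

  upds-untouched : ∀ Y x {p} → ¬ TouchesAny Y p → foldl (upd W) x Y p ≡ x p
  upds-untouched [] x _ = refl
  upds-untouched (w ∷ Y) x h =
    ≡-trans (upds-untouched Y (upd W x w) (h ∘ there)) (upd-untouched x (h ∘ here))

  upd-comm : ∀ z w → (∀ p → Touches z p → ¬ Touches w p) → ∀ x →
    upd W (upd W x z) w ≗ upd W (upd W x w) z
  upd-comm z w disjoint x p with touches? z p
  ... | yes tz = ≡-trans (upd-untouched (upd W x z) (disjoint p tz))
    (sym (upd-local z p (λ q zq → upd-untouched x (disjoint q (inj₁ zq)))
                        (upd-untouched x (disjoint p tz))))
  ... | no ¬tz = ≡-trans
    (upd-local w p (λ q wq → upd-untouched x (λ tz → disjoint q tz (inj₁ wq)))
                   (upd-untouched x ¬tz))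
    (sym (upd-untouched (upd W x w) ¬tz))

  upds-comm : ∀ Y x z → (∀ p → Touches z p → ¬ TouchesAny Y p) →
    foldl (upd W) (upd W x z) Y ≗ upd W (foldl (upd W) x Y) z
  upds-comm [] x z _ p = refl
  upds-comm (w ∷ Y) x z disjoint p = ≡-trans
    (upds-cong Y (upd-comm z w (λ q tz → disjoint q tz ∘ here) x) p)
    (upds-comm Y (upd W x w) z (λ q tz → disjoint q tz ∘ there) p)

  μ-++ : ∀ σ ρ → μ W (σ ++ ρ) ≡ foldl (upd W) (μ W σ) ρ
  μ-++ σ ρ = foldl-++ (upd W) (μ₀ W) σ ρ

  initial-time : ∀ p → 1 ≤ initial net p → μ₀ W p ≡ just 0
  initial-time p marked with p ≟ i
  ... | yes _ = refl
  initial-time p () | no _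

  Defined : (Fin nP → ℕ⊥) → Marking net → Set
  Defined x M = ∀ p → 1 ≤ M p → ∃ λ n → x p ≡ just n

  upd-defined : ∀ {M w x} → Reachable net M → Defined x M → Enabled net M w →
    Defined (upd W x w) (fire net M w)
  upd-defined {M} {w} {x} R def ew p marked with marked-after-fire R marked
  ... | inj₂ (¬wp , marked₀) =
    subst (λ v → ∃ λ n → v ≡ just n) (sym (upd-untouched x ¬wp)) (def p marked₀)
  ... | inj₁ w·p with preset-nonempty w
  ...   | p₀ , wp₀ with def p₀ (ew p₀ wp₀)
  ...     | n , x≡n with just≤⊥⇒just (≤⊥-trans (≤⊥-reflexive (sym x≡n)) (maxPre-upper w x wp₀))
  ...       | m , max≡m = m + τ w , ≡-trans (upd-output x w·p) (cong (_+⊥ τ w) max≡m)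

  upds-defined : ∀ Y {A B x} → Reachable net A → Defined x A → Run net A Y B →
    Defined (foldl (upd W) x Y) B
  upds-defined [] _ def done = def
  upds-defined (w ∷ Y) R def (step ew r) =
    upds-defined Y (reachable-fire R ew) (upd-defined R def ew) r

  μ-defined : ∀ {σ M} → Run net (initial net) σ M → Defined (μ W σ) M
  μ-defined {σ} r = upds-defined σ ([] , done) (λ p marked → 0 , initial-time p marked) r

  untouched-preset⇒disjoint : ∀ Y {M₁ M₂ z} → Reachable net M₁ → Run net M₁ Y M₂ →
    Enabled net M₂ z → (∀ p → pre z p ≡ true → ¬ TouchesAny Y p) →
    ∀ p → Touches z p → ¬ TouchesAny Y p
  untouched-preset⇒disjoint Y R r ez free p (inj₁ zp) = free p zp
  untouched-preset⇒disjoint (w ∷ Y) R r@(step ew r') ez free p (inj₂ z·p) (here (inj₁ wp)) =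
    free p (marked-output⇒consumed R (untouched-enabled (w ∷ Y) r ez free) z·p (ew p wp))
      (here (inj₁ wp))
  untouched-preset⇒disjoint (w ∷ Y) {M₁} R (step ew r') ez free p (inj₂ z·p) (here (inj₂ w·p)) =
    free p (marked-output⇒consumed (reachable-fire R ew)
               (untouched-enabled Y r' ez (λ q zq → free q zq ∘ there)) z·p (fire-output M₁ w·p))
      (here (inj₂ w·p))
  untouched-preset⇒disjoint (w ∷ Y) R (step ew r') ez free p (inj₂ z·p) (there touched) =
    untouched-preset⇒disjoint Y (reachable-fire R ew) r' ez (λ q zq → free q zq ∘ there)
      p (inj₂ z·p) touched

  fire-earlier : ∀ Y {M₁ M₂} z → Run net M₁ Y M₂ → (∀ p → Touches z p → ¬ TouchesAny Y p) →
    ∃ λ M₂' → Run net (fire net M₁ z) Y M₂' × M₂' ≗ fire net M₂ z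
  fire-earlier [] z done _ = _ , done , λ _ → refl
  fire-earlier (w ∷ Y) {M₁} z (step ew r) disjoint
    with fire-earlier Y z r (λ p tz → disjoint p tz ∘ there)
  ... | M₂'' , r'' , M₂''≗ with run-cong Y r'' (fire-comm M₁ z w (λ p tz → disjoint p tz ∘ here))
  ...   | M₂' , r' , M₂''≗M₂' = M₂' , step ew' r' , λ p → ≡-trans (sym (M₂''≗M₂' p)) (M₂''≗ p)
    where
    ew' : Enabled net (fire net M₁ z) w
    ew' p wp =
      ≤-trans (ew p wp) (fire-unconsumed M₁ (¬-not (λ zp → disjoint p (inj₁ zp) (here (inj₁ wp)))))

  TimesAbove : ℕ⊥ → List (Fin nT) → Marking net → (Fin nP → ℕ⊥) → Set
  TimesAbove T Y M x = ∀ p → TouchesAny Y p → 1 ≤ M p → T ≤⊥ x p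

  timesAbove-∷ʳ : ∀ {T Y M x z p₀} → Reachable net M → TimesAbove T Y M x → Enabled net M z →
    pre z p₀ ≡ true → TouchesAny Y p₀ → TimesAbove T (Y ∷ʳ z) (fire net M z) (upd W x z)
  timesAbove-∷ʳ {T} {Y} {x = x} {z} {p₀} R above ez zp₀ touched₀ p touched marked
    with marked-after-fire R marked
  ... | inj₁ z·p = begin
    T                    ≲⟨ above p₀ touched₀ (ez p₀ zp₀) ⟩
    x p₀                 ≲⟨ maxPre-upper z x zp₀ ⟩
    maxPre W z x         ≲⟨ +⊥-inflationary _ (τ z) ⟩
    maxPre W z x +⊥ τ z  ≡⟨ upd-output x z·p ⟨
    upd W x z p          ∎
    where open ≤⊥-Reasoning
  ... | inj₂ (¬zp , marked₀) with ++⁻ Y touched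
  ...   | inj₁ touched₀ =
    ≤⊥-trans (above p touched₀ marked₀) (≤⊥-reflexive (sym (upd-untouched x ¬zp)))
  ...   | inj₂ (here zp) = contradiction zp ¬zp

  producer-touches-conflict : ∀ {M₁ M₂ y Y t u q} → Reachable net M₁ → Run net M₁ (y ∷ Y) M₂ →
    post y q ≡ true → Enabled net M₂ t → Enabled net M₂ u → Dependent net t u → pre u q ≡ true →
    ∃ λ p → pre t p ≡ true × TouchesAny (y ∷ Y) p
  producer-touches-conflict {M₁} {y = y} {Y} {t} {u} {q} R r@(step ey _) y·q et eu dep uq
    with any? (λ p → (pre t p ≟ᵇ true) ×-dec touchesAny? (y ∷ Y) p)
  ... | yes touched = touched
  ... | no untouched-t = contradiction (marked-output⇒consumed R ey y·q q-marked) (not-¬ y-keeps-q)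
    where
    free : ∀ p → pre t p ≡ true → ¬ TouchesAny (y ∷ Y) p
    free p tp touched = untouched-t (p , tp , touched)
    cf = confusion-free M₁ R y t ey
      (ey , untouched-enabled (y ∷ Y) r et free , untouched⇒independent free)
    u-enabled : Enabled net (removePre net M₁ y) u
    u-enabled =
      proj₁ (Equivalence.to (proj₁ cf u) (conflict-backward (y ∷ Y) R r et free (eu , dep)))
    y-keeps-q : pre y q ≡ false
    y-keeps-q = proj₁ (removePre-marked M₁ (u-enabled q uq))
    q-marked : 1 ≤ M₁ q
    q-marked = proj₂ (removePre-marked M₁ (u-enabled q uq))

  module _ {t u q} (dep : Dependent net t u) (uq : pre u q ≡ true) where

    downstream-bound : ∀ ρ {M₁ M₂ M} x y Y T → Reachable net M₁ →
      Run net M₁ (y ∷ Y) M₂ → Run net M₂ ρ M → post y q ≡ true →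
      TimesAbove T (y ∷ Y) M₂ (foldl (upd W) x (y ∷ Y)) → Enabled net M t → Enabled net M u →
      T ≤⊥ maxPre W t (foldl (upd W) (foldl (upd W) x (y ∷ Y)) ρ)
    downstream-bound [] x y Y T R r done y·q above et eu
      with producer-touches-conflict R r y·q et eu dep uq
    ... | p , tp , touched = ≤⊥-trans (above p touched (et p tp)) (maxPre-upper t _ tp)
    downstream-bound (z ∷ ρ) {M₁} {M₂} x y Y T R r (step ez r') y·q above et eu
      with any? (λ p → (pre z p ≟ᵇ true) ×-dec touchesAny? (y ∷ Y) p)
    ... | yes (p₀ , zp₀ , touched₀) =
      subst (λ x' → T ≤⊥ maxPre W t (foldl (upd W) x' ρ)) x₂≡
        (downstream-bound ρ x y (Y ∷ʳ z) T R (run-++ (y ∷ Y) r (step ez done)) r' y·q above' et eu)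
      where
      x₂≡ = foldl-∷ʳ (upd W) x z (y ∷ Y)
      above' : TimesAbove T (y ∷ Y ∷ʳ z) (fire net M₂ z) (foldl (upd W) x (y ∷ Y ∷ʳ z))
      above' p touched marked = ≤⊥-trans
        (timesAbove-∷ʳ (reachable-run (y ∷ Y) R r) above ez zp₀ touched₀ p touched marked)
        (≤⊥-reflexive (sym (cong-app x₂≡ p)))
    ... | no shared = commute (fire-earlier (y ∷ Y) z r disjoint)
      where
      disjoint : ∀ p → Touches z p → ¬ TouchesAny (y ∷ Y) p
      disjoint =
        untouched-preset⇒disjoint (y ∷ Y) R r ez (λ p zp touched → shared (p , zp , touched))

      commute : (∃ λ M₂' → Run net (fire net M₁ z) (y ∷ Y) M₂' × M₂' ≗ fire net M₂ z) →
        T ≤⊥ maxPre W t (foldl (upd W) (upd W (foldl (upd W) x (y ∷ Y)) z) ρ)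
      commute (M₂' , r₂' , M₂'≗) with run-cong ρ r' (sym ∘ M₂'≗)
      ... | M' , r'' , M≗M' =
        subst (T ≤⊥_) (maxPre-cong t (λ p _ → upds-cong ρ (upds-comm (y ∷ Y) x z disjoint) p))
          (downstream-bound ρ (upd W x z) y Y T R₁ r₂' r'' y·q above'
            (enabled-cong M≗M' et) (enabled-cong M≗M' eu))
        where
        R₁ = reachable-fire R (untouched-enabled (y ∷ Y) r ez (λ p zp → disjoint p (inj₁ zp)))
        above' : TimesAbove T (y ∷ Y) M₂' (foldl (upd W) (upd W x z) (y ∷ Y))
        above' p touched marked = ≤⊥-trans (above p touched marked₂)
            (≤⊥-reflexive (sym (≡-trans (upds-comm (y ∷ Y) x z disjoint p) (upd-untouched _ ¬zp))))
          where
          ¬zp = λ tz → disjoint p tz touched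
          marked₂ = subst (1 ≤_) (≡-trans (M₂'≗ p) (fire-untouched M₂ ¬zp)) marked

  conflict-time-bound : ∀ {σ M t u q} → Run net (initial net) σ M →
    Enabled net M t → Enabled net M u → Dependent net t u → pre u q ≡ true →
    μ W σ q ≤⊥ maxPre W t (μ W σ)
  conflict-time-bound {σ} {t = t} {q = q} r et eu dep@(p , tp , up) uq
    with lastOccurrence (λ w → touches? w q) σ
  ... | none untouched-q with μ-defined r p (eu p up)
  ...   | n , p-time = begin
    μ W σ q             ≡⟨ q-time ⟩
    just 0              ≲⟨ just≤just z≤n ⟩
    just n              ≡⟨ p-time ⟨
    μ W σ p             ≲⟨ maxPre-upper t (μ W σ) tp ⟩
    maxPre W t (μ W σ)  ∎
    where
    open ≤⊥-Reasoning
    q-time : μ W σ q ≡ just 0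
    q-time = ≡-trans (upds-untouched σ (μ₀ W) untouched-q)
      (initial-time q (subst (1 ≤_) (run-untouched σ r untouched-q) (eu q uq)))
  conflict-time-bound {t = t} {q = q} r et eu dep uq | at σ₁ {y} ρ yq untouched-q
    rewrite μ-++ σ₁ (y ∷ ρ) with run-++⁻ σ₁ r
  ... | M₁ , r₁ , step ey r₂ =
    subst (_≤⊥ _) (sym q-time)
      (downstream-bound dep uq ρ x y [] T R₁ (step ey done) r₂ y·q above et eu)
    where
    x = μ W σ₁
    T = maxPre W y x +⊥ τ y
    R₁ : Reachable net M₁
    R₁ = σ₁ , r₁
    y·q : post y q ≡ true
    y·q = touched-marked⇒output R₁ yq (subst (1 ≤_) (run-untouched ρ r₂ untouched-q) (eu q uq))
    q-time : foldl (upd W) (upd W x y) ρ q ≡ T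
    q-time = ≡-trans (upds-untouched ρ (upd W x y) untouched-q) (upd-output x y·q)
    above : TimesAbove T (y ∷ []) (fire net M₁ y) (upd W x y)
    above p (here yp) marked =
      ≤⊥-reflexive (sym (upd-output x (touched-marked⇒output R₁ yp marked)))

lemma7 : (W : TPWN) → let open TPWN W in
    (σ : List (Fin nT)) (M : Marking net) → Run net (initial net) σ M →
    (t₀ : Fin nT) → Enabled net M t₀ →
    (t : Fin nT) → ConflictSet net t₀ M t →
    start W (σ ∷ʳ t) ≡ maxOver (presetOf? net (conflictSet? net t₀ M)) (μ W σ)
lemma7 W σ M r t₀ et₀ t t∈C = ≡-trans (start-∷ʳ W σ t) (≤⊥-antisym
  (maxOver-lub (λ q → pre t q ≟ᵇ true) (μ W σ) λ q tq →
    maxOver-upper •C? (μ W σ) q (t , t∈C , tq))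
  (maxOver-lub •C? (μ W σ) λ { q (v , v∈C , vq) →
    conflict-time-bound W r (proj₁ t∈C) (proj₁ v∈C)
      (conflictSet-dependent W (σ , r) et₀ t∈C v∈C) vq }))
  where
  open TPWN W
  •C? = presetOf? net (conflictSet? net t₀ M)
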